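{- Let $G=(V,E)$ be a strongly connected $d$-out digraph which is periodic with periodic partition $\Pi=\{P_1,\ldots,P_t\}$, and let $S=\langle R_1,\ldots,R_d\rangle$ be a coloring semigroup of $G$. If $[v]$ is an equivalence class of vertices of the stability relation $\equiv_S$, then $[v]\subset P_k$ for some $k$, $1\le k\le t$.
   Context: A $d$-out digraph has every vertex of out-degree $d$ (multiple edges allowed). A coloring is a decomposition of the adjacency matrix $\mathcal A=R_1+\cdots+R_d$ into 0-1 stochastic matrices, each identified with a map $V\to V$ ($jR_i=k$ iff $(R_i)_{jk}=1$; maps act on the right, so $R_i$ follows edges of color $i$). The coloring semigroup $S$ is the semigroup they generate under composition. The stability relation: $x\equiv_S y$ iff for every $W_1\in S$ there exists $W_2\in S$ with $xW_1W_2=yW_1W_2$. $G$ is periodic of period $t\ge2$ with periodic partition $\{P_1,\ldots,P_t\}$ if every edge from a vertex of $P_k$ ends in $P_{k+1}$ (indices mod $t$) and $t$ is the largest integer for which such a partition exists. -}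

module Defs where

open import Data.Nat using (ℕ; zero; suc; _≤_)
open import Data.Fin using (Fin; toℕ)
open import Data.List using (List; []; _∷_)
open import Data.List.NonEmpty using (List⁺; toList)
open import Data.Product using (Σ; ∃; ∃-syntax; _×_)
open import Data.Sum using (_⊎_)
open import Relation.Binary.PropositionalEquality using (_≡_)
open import Relation.Binary.Construct.Closure.ReflexiveTransitive using (Star)
open import Function.Definitions using (Surjective)

-- The digraph G is the one with adjacency matrix R_1 + ... + R_d,
-- i.e. one edge x → R i x for each color i (multiple edges allowed).
Coloring : ℕ → ℕ → Set
Coloring n d = Fin d → Fin n → Fin n

-- Right action of a word over the colors: x (R_{i1} R_{i2} ...) .
act : ∀ {n d} → Coloring n d → Fin n → List (Fin d) → Fin n
act R x []       = x
act R x (i ∷ w) = act R (R i x) w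

-- Elements of the coloring semigroup S = ⟨R_1,…,R_d⟩ are nonempty words.
actS : ∀ {n d} → Coloring n d → Fin n → List⁺ (Fin d) → Fin n
actS R x W = act R x (toList W)

Edge : ∀ {n d} → Coloring n d → Fin n → Fin n → Set
Edge R x y = ∃[ i ] R i x ≡ y

StronglyConnected : ∀ {n d} → Coloring n d → Set
StronglyConnected {n} R = (x y : Fin n) → Star (Edge R) x y

Stable : ∀ {n d} → Coloring n d → Fin n → Fin n → Set
Stable {n} {d} R x y =
  (W₁ : List⁺ (Fin d)) → Σ (List⁺ (Fin d)) λ W₂ →
    actS R (actS R x W₁) W₂ ≡ actS R (actS R y W₁) W₂

NextBlock : ∀ {t} → Fin t → Fin t → Set
NextBlock {t} k j = suc (toℕ k) ≡ toℕ j ⊎ (suc (toℕ k) ≡ t × toℕ j ≡ 0)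

-- A partition of V into t (nonempty) blocks P_0,…,P_{t-1}, given by the
-- block-assignment map, such that every edge goes from P_k to P_{k+1 mod t}.
CyclicPartition : ∀ {n d} → Coloring n d → (t : ℕ) → (Fin n → Fin t) → Set
CyclicPartition {n} R t P =
  Surjective _≡_ _≡_ P × ((x : Fin n) (y : Fin n) → Edge R x y → NextBlock (P x) (P y))

PeriodicWith : ∀ {n d} → Coloring n d → (t : ℕ) → (Fin n → Fin t) → Set
PeriodicWith {n} R t P =
  2 ≤ t × CyclicPartition R t P ×
  ((t' : ℕ) (P' : Fin n → Fin t') → CyclicPartition R t' P' → t' ≤ t)

module Submission where

-- The key observation is that an edge-compatible block assignment P can be
-- run backwards: since the successor of a block index modulo t is unique
-- (NextBlock is injective in its first argument), two vertices whose images
-- under a color R_i lie in the same block already lie in the same block, and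
-- by induction the same holds for images under any word.  If u ≡_S v and at
-- least one color exists, stability applied to a one-letter word W₁ yields a
-- word W₁W₂ merging u and v, so P u ≡ P v.  With no colors at all, strong
-- connectivity forces every vertex to be equal to every other one.

open import Defs
open import Data.Nat using (ℕ; suc)
open import Data.Nat.Properties using (suc-injective)
open import Data.Fin using (Fin; zero)
open import Data.Fin.Properties using (toℕ-injective)
open import Data.Product using (∃-syntax; _,_)
open import Data.Sum using (inj₁; inj₂)
open import Data.List using (List; []; _∷_)
open import Data.List.NonEmpty using (toList; _∷_)
open import Relation.Binary.PropositionalEquality
  using (_≡_; refl; sym; trans; cong; subst)
open import Relation.Binary.Construct.Closure.ReflexiveTransitive using (Star; ε; _◅_)

nextBlock-injective : ∀ {t} {k k' j : Fin t} → NextBlock k j → NextBlock k' j → k ≡ k'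
nextBlock-injective (inj₁ p)       (inj₁ q)       = toℕ-injective (suc-injective (trans p (sym q)))
nextBlock-injective (inj₁ p)       (inj₂ (_ , q)) with () ← trans p q
nextBlock-injective (inj₂ (_ , q)) (inj₁ p)       with () ← trans p q
nextBlock-injective (inj₂ (p , _)) (inj₂ (q , _)) = toℕ-injective (suc-injective (trans p (sym q)))

-- Stable vertices of a coloring with at least one color are merged by a word:
-- stability for the one-letter word W₁ = R₀ yields W₂ with u W₁W₂ = v W₁W₂.
stable⇒merged : ∀ {n d} (R : Coloring n (suc d)) {u v : Fin n} →
  Stable R u v → ∃[ w ] act R u w ≡ act R v w
stable⇒merged R st with st (zero ∷ [])
... | W₂ , merge = zero ∷ toList W₂ , merge

module BlocksReflected {n d t : ℕ} (R : Coloring n d) (P : Fin n → Fin t)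
  (compatible : (x y : Fin n) → Edge R x y → NextBlock (P x) (P y)) where

  sameBlock-by-color : (i : Fin d) (x y : Fin n) → P (R i x) ≡ P (R i y) → P x ≡ P y
  sameBlock-by-color i x y same =
    nextBlock-injective (compatible x (R i x) (i , refl))
                        (subst (NextBlock (P y)) (sym same) (compatible y (R i y) (i , refl)))

  sameBlock-by-word : (w : List (Fin d)) (x y : Fin n) →
    P (act R x w) ≡ P (act R y w) → P x ≡ P y
  sameBlock-by-word []      x y same = same
  sameBlock-by-word (i ∷ w) x y same =
    sameBlock-by-color i x y (sameBlock-by-word w (R i x) (R i y) same)

  merged⇒sameBlock : {x y : Fin n} → ∃[ w ] act R x w ≡ act R y w → P x ≡ P y
  merged⇒sameBlock (w , merge) = sameBlock-by-word w _ _ (cong P merge)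

colorless-path-trivial : ∀ {n} (R : Coloring n 0) {x y : Fin n} → Star (Edge R) x y → x ≡ y
colorless-path-trivial R ε              = refl
colorless-path-trivial R ((() , _) ◅ _)

mainTheorem3 : (n d t : ℕ) (R : Coloring n d) (P : Fin n → Fin t) →
    StronglyConnected R → PeriodicWith R t P →
    (v : Fin n) → ∃[ k ] ((u : Fin n) → Stable R u v → P u ≡ k)
mainTheorem3 n 0       t R P connected _ v =
  P v , λ u _ → cong P (colorless-path-trivial R (connected u v))
mainTheorem3 n (suc d) t R P _ (_ , (_ , compatible) , _) v =
  P v , λ u stable → merged⇒sameBlock (stable⇒merged R stable)
  where open BlocksReflected R P compatible
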